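{- There is no finite simple graph $G$ with $\alpha(G)>|V(G)|/2$ such that either (i) $\xi(G)=1$ and $|V(G)|$ is even, or (ii) $\xi(G)=0$.
   Context: $\alpha(G)$ is the maximum size of a stable set; $\Omega(G)$ is the set of maximum stable sets; $core(G)=\bigcap\{S:S\in\Omega(G)\}$ and $\xi(G)=|core(G)|$. -}

module Defs where

open import Data.Nat using (ℕ; _≤_)
open import Data.Bool using (Bool; true; false; T)
open import Data.Fin using (Fin)
open import Data.Fin.Subset using (Subset; _∈_; ∣_∣)
open import Data.Product using (_×_)
open import Relation.Binary.PropositionalEquality using (_≡_)
open import Relation.Nullary using (¬_)
open import Function.Bundles using (_⇔_)

record SimpleGraph (n : ℕ) : Set where
  field
    Adj   : Fin n → Fin n → Bool
    sym   : ∀ u v → Adj u v ≡ Adj v u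
    irrefl : ∀ v → Adj v v ≡ false
open SimpleGraph public

IsStable : ∀ {n} → SimpleGraph n → Subset n → Set
IsStable G S = ∀ u v → u ∈ S → v ∈ S → ¬ T (Adj G u v)

-- S ∈ Ω(G): S is a stable set of maximum size (so ∣ S ∣ = α(G)).
IsMaxStable : ∀ {n} → SimpleGraph n → Subset n → Set
IsMaxStable G S = IsStable G S × (∀ S′ → IsStable G S′ → ∣ S′ ∣ ≤ ∣ S ∣)

-- C = core(G): the intersection of all maximum stable sets (so ∣ C ∣ = ξ(G)).
IsCore : ∀ {n} → SimpleGraph n → Subset n → Set
IsCore {n} G C = ∀ (v : Fin n) → (v ∈ C) ⇔ (∀ S → IsMaxStable G S → v ∈ S)

{-# OPTIONS --safe #-}
module Submission where

-- For a stable set A consider its surplus |A| − |N(A)|. If a maximum stable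
-- set S misses a vertex of A, then A ∪ (S ∖ N(A)) is stable, hence no larger
-- than S, and this exchange shows that the strictly smaller stable set A ∩ S
-- has surplus at least that of A. By well-founded induction a stable set whose
-- surplus exceeds ξ(G) would lie in every maximum stable set, i.e. in core(G),
-- and so have at most ξ(G) elements, which is absurd. So every stable set has
-- surplus at most ξ(G); as a maximum stable set S is disjoint from N(S), this
-- gives 2α(G) ≤ |V(G)| + ξ(G), which rules out α(G) > |V(G)|/2 when ξ(G) = 0,
-- and when ξ(G) = 1 it forces |V(G)| to be odd.

open import Defs
open import Data.Nat using (ℕ; _<_; _*_)
open import Data.Nat.Divisibility using (_∣_)
open import Data.Fin.Subset using (Subset; ∣_∣)
open import Data.Product using (_×_)
open import Data.Sum using (_⊎_)
open import Relation.Binary.PropositionalEquality using (_≡_)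
open import Relation.Nullary using (¬_)

open import Level using (Level)
open import Data.Bool using (true; false; T)
open import Data.Nat using (suc; _+_; _≤_)
open import Data.Nat.Properties
open import Algebra.Properties.CommutativeSemigroup +-commutativeSemigroup
  using (xy∙z≈xz∙y; xy∙z≈zx∙y)
open import Data.Nat.Divisibility using (∣m+n∣m⇒∣n; ∣1⇒≡1; m∣m*n)
open import Data.Fin using (Fin)
open import Data.Fin.Properties using (any?)
open import Data.Fin.Subset using (_∈_; _∉_; _⊆_; _⊂_; _∩_; _∪_; ∁; ⊥; Empty)
open import Data.Fin.Subset.Properties
open import Data.Fin.Subset.Induction using (⊂-wellFounded)
open import Data.Vec using ([]; _∷_; tabulate)
open import Data.Vec.Properties using (lookup∘tabulate; lookup⇒[]=; []=⇒lookup)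
open import Data.Product using (_,_; proj₁; proj₂; ∃)
open import Data.Sum using (inj₁; inj₂)
open import Function using (_∘_; _⇔_; Equivalence; mk⇔)
open import Induction.WellFounded using (Acc; acc)
open import Relation.Binary.PropositionalEquality as ≡
  using (refl; trans; cong; subst; module ≡-Reasoning)
open import Relation.Nullary using (does; yes)
open import Relation.Nullary.Decidable using (dec-true; decidable-stable; _×-dec_; T?)
open import Relation.Unary using (Pred; Decidable)

private
  variable
    ℓ : Level
    n : ℕ

∣p∪q∣+∣p∩q∣≡∣p∣+∣q∣ : (p q : Subset n) → ∣ p ∪ q ∣ + ∣ p ∩ q ∣ ≡ ∣ p ∣ + ∣ q ∣
∣p∪q∣+∣p∩q∣≡∣p∣+∣q∣ []          []          = refl
∣p∪q∣+∣p∩q∣≡∣p∣+∣q∣ (true  ∷ p) (true  ∷ q) =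
  cong suc (trans (+-suc _ _) (trans (cong suc (∣p∪q∣+∣p∩q∣≡∣p∣+∣q∣ p q)) (≡.sym (+-suc _ _))))
∣p∪q∣+∣p∩q∣≡∣p∣+∣q∣ (true  ∷ p) (false ∷ q) = cong suc (∣p∪q∣+∣p∩q∣≡∣p∣+∣q∣ p q)
∣p∪q∣+∣p∩q∣≡∣p∣+∣q∣ (false ∷ p) (true  ∷ q) =
  trans (cong suc (∣p∪q∣+∣p∩q∣≡∣p∣+∣q∣ p q)) (≡.sym (+-suc _ _))
∣p∪q∣+∣p∩q∣≡∣p∣+∣q∣ (false ∷ p) (false ∷ q) = ∣p∪q∣+∣p∩q∣≡∣p∣+∣q∣ p q

∣p∩q∣+∣p∩∁q∣≡∣p∣ : (p q : Subset n) → ∣ p ∩ q ∣ + ∣ p ∩ ∁ q ∣ ≡ ∣ p ∣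
∣p∩q∣+∣p∩∁q∣≡∣p∣ []          []          = refl
∣p∩q∣+∣p∩∁q∣≡∣p∣ (true  ∷ p) (true  ∷ q) = cong suc (∣p∩q∣+∣p∩∁q∣≡∣p∣ p q)
∣p∩q∣+∣p∩∁q∣≡∣p∣ (true  ∷ p) (false ∷ q) = trans (+-suc _ _) (cong suc (∣p∩q∣+∣p∩∁q∣≡∣p∣ p q))
∣p∩q∣+∣p∩∁q∣≡∣p∣ (false ∷ p) (_     ∷ q) = ∣p∩q∣+∣p∩∁q∣≡∣p∣ p q

Empty[p∩q]⇒∣p∣+∣q∣≤n : (p q : Subset n) → Empty (p ∩ q) → ∣ p ∣ + ∣ q ∣ ≤ n
Empty[p∩q]⇒∣p∣+∣q∣≤n {n} p q p∩q-empty = begin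
  ∣ p ∣ + ∣ q ∣               ≡⟨ ≡.sym (∣p∪q∣+∣p∩q∣≡∣p∣+∣q∣ p q) ⟩
  ∣ p ∪ q ∣ + ∣ p ∩ q ∣       ≡⟨ cong (λ r → ∣ p ∪ q ∣ + ∣ r ∣) (Empty-unique p∩q-empty) ⟩
  ∣ p ∪ q ∣ + ∣ ⊥ {n} ∣       ≡⟨ cong (∣ p ∪ q ∣ +_) (∣⊥∣≡0 n) ⟩
  ∣ p ∪ q ∣ + 0               ≡⟨ +-identityʳ _ ⟩
  ∣ p ∪ q ∣                   ≤⟨ ∣p∣≤n (p ∪ q) ⟩
  n                           ∎
  where open ≤-Reasoning

∈-tabulate⇔ : {P : Pred (Fin n) ℓ} (P? : Decidable P) {x : Fin n} →
              x ∈ tabulate (does ∘ P?) ⇔ P x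
∈-tabulate⇔ {P = P} P? {x} = mk⇔ to (λ Px → lookup⇒[]= x _ (trans (lookup∘tabulate _ x) (dec-true (P? x) Px)))
  where
  to : x ∈ tabulate (does ∘ P?) → P x
  to x∈ with P? x | trans (≡.sym (lookup∘tabulate _ x)) ([]=⇒lookup x∈)
  ... | yes Px | _ = Px

module _ (G : SimpleGraph n) where

  adjacentTo? : (A : Subset n) → Decidable (λ v → ∃ λ u → u ∈ A × T (Adj G u v))
  adjacentTo? A v = any? (λ u → u ∈? A ×-dec T? (Adj G u v))

  neighbourhood : Subset n → Subset n
  neighbourhood A = tabulate (does ∘ adjacentTo? A)

  ∈-neighbourhood⁺ : ∀ {A u v} → u ∈ A → T (Adj G u v) → v ∈ neighbourhood A
  ∈-neighbourhood⁺ {A} u∈A uv = Equivalence.from (∈-tabulate⇔ (adjacentTo? A)) (_ , u∈A , uv)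

  ∈-neighbourhood⁻ : ∀ {A v} → v ∈ neighbourhood A → ∃ λ u → u ∈ A × T (Adj G u v)
  ∈-neighbourhood⁻ {A} = Equivalence.to (∈-tabulate⇔ (adjacentTo? A))

  neighbourhood-mono : ∀ {A B} → A ⊆ B → neighbourhood A ⊆ neighbourhood B
  neighbourhood-mono A⊆B v∈NA with ∈-neighbourhood⁻ v∈NA
  ... | u , u∈A , uv = ∈-neighbourhood⁺ (A⊆B u∈A) uv

  stable⇒Empty[N[B]∩A] : ∀ {A B} → IsStable G A → B ⊆ A → Empty (neighbourhood B ∩ A)
  stable⇒Empty[N[B]∩A] {A} {B} stable B⊆A (v , v∈NB∩A) with ∈-neighbourhood⁻ (proj₁ (x∈p∩q⁻ _ A v∈NB∩A))
  ... | u , u∈B , uv = stable u v (B⊆A u∈B) (proj₂ (x∈p∩q⁻ _ A v∈NB∩A)) uv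

  stable-⊆ : ∀ {A B} → B ⊆ A → IsStable G A → IsStable G B
  stable-⊆ B⊆A stable u v u∈B v∈B = stable u v (B⊆A u∈B) (B⊆A v∈B)

  exchange-stable : ∀ {A S} → IsStable G A → IsStable G S →
                    IsStable G (A ∪ (S ∩ ∁ (neighbourhood A)))
  exchange-stable {A} {S} stA stS u v u∈ v∈ uv
    with x∈p∪q⁻ A _ u∈ | x∈p∪q⁻ A _ v∈
  ... | inj₁ u∈A | inj₁ v∈A = stA u v u∈A v∈A uv
  ... | inj₂ u∈S∖N | inj₂ v∈S∖N = stS u v (p∩q⊆p S _ u∈S∖N) (p∩q⊆p S _ v∈S∖N) uv
  ... | inj₁ u∈A | inj₂ v∈S∖N =
    x∈∁p⇒x∉p (p∩q⊆q S _ v∈S∖N) (∈-neighbourhood⁺ u∈A uv)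
  ... | inj₂ u∈S∖N | inj₁ v∈A =
    x∈∁p⇒x∉p (p∩q⊆q S _ u∈S∖N) (∈-neighbourhood⁺ v∈A (subst T (SimpleGraph.sym G u v) uv))

  ∣A∣≤∣A∩S∣+∣S∩N[A]∣ : ∀ {A S} → IsStable G A → IsMaxStable G S →
                       ∣ A ∣ ≤ ∣ A ∩ S ∣ + ∣ S ∩ neighbourhood A ∣
  ∣A∣≤∣A∩S∣+∣S∩N[A]∣ {A} {S} stA (stS , maxS) = +-cancelʳ-≤ ∣ S∖N ∣ _ _ (begin
    ∣ A ∣ + ∣ S∖N ∣                       ≡⟨ ≡.sym (∣p∪q∣+∣p∩q∣≡∣p∣+∣q∣ A S∖N) ⟩
    ∣ A ∪ S∖N ∣ + ∣ A ∩ S∖N ∣              ≤⟨ +-mono-≤ (maxS _ (exchange-stable stA stS)) A∩S∖N≤A∩S ⟩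
    ∣ S ∣ + ∣ A ∩ S ∣                      ≡⟨ cong (_+ ∣ A ∩ S ∣) (≡.sym (∣p∩q∣+∣p∩∁q∣≡∣p∣ S N)) ⟩
    (∣ S ∩ N ∣ + ∣ S∖N ∣) + ∣ A ∩ S ∣      ≡⟨ xy∙z≈zx∙y ∣ S ∩ N ∣ _ _ ⟩
    (∣ A ∩ S ∣ + ∣ S ∩ N ∣) + ∣ S∖N ∣      ∎)
    where
    open ≤-Reasoning
    N = neighbourhood A
    S∖N = S ∩ ∁ N
    A∩S∖N≤A∩S : ∣ A ∩ S∖N ∣ ≤ ∣ A ∩ S ∣
    A∩S∖N≤A∩S = subst (λ r → ∣ r ∣ ≤ ∣ A ∩ S ∣) (∩-assoc A S (∁ N)) (∣p∩q∣≤∣p∣ (A ∩ S) (∁ N))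

  N[A∩S]⊆N[A]∩∁S : ∀ {A S} → IsStable G S →
                   neighbourhood (A ∩ S) ⊆ neighbourhood A ∩ ∁ S
  N[A∩S]⊆N[A]∩∁S {A} {S} stS {v} v∈ = x∈p∩q⁺
    ( neighbourhood-mono (p∩q⊆p A S) v∈
    , x∉p⇒x∈∁p (λ v∈S → stable⇒Empty[N[B]∩A] stS (p∩q⊆q A S) (v , x∈p∩q⁺ (v∈ , v∈S))))

  surplus[A]≤surplus[A∩S] : ∀ {A S} → IsStable G A → IsMaxStable G S →
                            ∣ A ∣ + ∣ neighbourhood (A ∩ S) ∣ ≤ ∣ A ∩ S ∣ + ∣ neighbourhood A ∣
  surplus[A]≤surplus[A∩S] {A} {S} stA maxS = begin
    ∣ A ∣ + ∣ neighbourhood (A ∩ S) ∣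
      ≤⟨ +-mono-≤ (∣A∣≤∣A∩S∣+∣S∩N[A]∣ stA maxS) (p⊆q⇒∣p∣≤∣q∣ (N[A∩S]⊆N[A]∩∁S (proj₁ maxS))) ⟩
    (∣ A ∩ S ∣ + ∣ S ∩ N ∣) + ∣ N ∩ ∁ S ∣    ≡⟨ +-assoc ∣ A ∩ S ∣ _ _ ⟩
    ∣ A ∩ S ∣ + (∣ S ∩ N ∣ + ∣ N ∩ ∁ S ∣)    ≡⟨ cong (λ r → ∣ A ∩ S ∣ + (∣ r ∣ + ∣ N ∩ ∁ S ∣)) (∩-comm S N) ⟩
    ∣ A ∩ S ∣ + (∣ N ∩ S ∣ + ∣ N ∩ ∁ S ∣)    ≡⟨ cong (∣ A ∩ S ∣ +_) (∣p∩q∣+∣p∩∁q∣≡∣p∣ N S) ⟩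
    ∣ A ∩ S ∣ + ∣ N ∣                        ∎
    where
    open ≤-Reasoning
    N = neighbourhood A

  surplus≤ξ : ∀ {C} → IsCore G C → ∀ {A} → IsStable G A → ∣ A ∣ ≤ ∣ C ∣ + ∣ neighbourhood A ∣
  surplus≤ξ {C} core {A} = ≮⇒≥ ∘ bounded (⊂-wellFounded A)
    where
    bounded : ∀ {A} → Acc _⊂_ A → IsStable G A → ¬ (∣ C ∣ + ∣ neighbourhood A ∣ < ∣ A ∣)
    bounded {A} (acc smaller) stA excess = <⇒≱ excess (≤-trans (p⊆q⇒∣p∣≤∣q∣ A⊆C) (m≤m+n _ _))
      where
      excess-∩ : ∀ {S} → IsMaxStable G S → ∣ C ∣ + ∣ neighbourhood (A ∩ S) ∣ < ∣ A ∩ S ∣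
      excess-∩ {S} maxS = +-cancelʳ-< ∣ neighbourhood A ∣ _ _ (begin-strict
        (∣ C ∣ + ∣ neighbourhood (A ∩ S) ∣) + ∣ neighbourhood A ∣
          ≡⟨ xy∙z≈xz∙y ∣ C ∣ _ _ ⟩
        (∣ C ∣ + ∣ neighbourhood A ∣) + ∣ neighbourhood (A ∩ S) ∣
          <⟨ +-monoˡ-< ∣ neighbourhood (A ∩ S) ∣ excess ⟩
        ∣ A ∣ + ∣ neighbourhood (A ∩ S) ∣
          ≤⟨ surplus[A]≤surplus[A∩S] stA maxS ⟩
        ∣ A ∩ S ∣ + ∣ neighbourhood A ∣ ∎)
        where open ≤-Reasoning

      A∩S⊂A : ∀ {S x} → x ∈ A → x ∉ S → A ∩ S ⊂ A
      A∩S⊂A {S} {x} x∈A x∉S = p∩q⊆p A S , x , x∈A , x∉S ∘ proj₂ ∘ x∈p∩q⁻ A S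

      A⊆C : A ⊆ C
      A⊆C {x} x∈A = Equivalence.from (core x) λ S maxS → decidable-stable (x ∈? S) λ x∉S →
        bounded (smaller (A∩S⊂A x∈A x∉S)) (stable-⊆ (p∩q⊆p A S) stA) (excess-∩ maxS)

  2α≤n+ξ : ∀ {S C} → IsMaxStable G S → IsCore G C → 2 * ∣ S ∣ ≤ n + ∣ C ∣
  2α≤n+ξ {S} {C} maxS core = begin
    2 * ∣ S ∣                                  ≡⟨ cong (∣ S ∣ +_) (+-identityʳ ∣ S ∣) ⟩
    ∣ S ∣ + ∣ S ∣                              ≤⟨ +-monoˡ-≤ ∣ S ∣ (surplus≤ξ core (proj₁ maxS)) ⟩
    (∣ C ∣ + ∣ neighbourhood S ∣) + ∣ S ∣      ≡⟨ +-assoc ∣ C ∣ _ _ ⟩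
    ∣ C ∣ + (∣ neighbourhood S ∣ + ∣ S ∣)      ≤⟨ +-monoʳ-≤ ∣ C ∣ N[S]+S≤n ⟩
    ∣ C ∣ + n                                  ≡⟨ +-comm ∣ C ∣ n ⟩
    n + ∣ C ∣                                  ∎
    where
    open ≤-Reasoning
    N[S]+S≤n : ∣ neighbourhood S ∣ + ∣ S ∣ ≤ n
    N[S]+S≤n = Empty[p∩q]⇒∣p∣+∣q∣≤n _ S (stable⇒Empty[N[B]∩A] (proj₁ maxS) ⊆-refl)

corollary3 : (n : ℕ) (G : SimpleGraph n) (S C : Subset n)
    → IsMaxStable G S → IsCore G C
    → n < 2 * ∣ S ∣
    → ¬ ((∣ C ∣ ≡ 1 × 2 ∣ n) ⊎ ∣ C ∣ ≡ 0)
corollary3 n G S C maxS core n<2α = λ where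
    (inj₂ ξ≡0) → <⇒≱ n<2α (≤-trans (2α≤n+ ξ≡0) (≤-reflexive (+-identityʳ n)))
    (inj₁ (ξ≡1 , 2∣n)) → 2≢1 (∣1⇒≡1 (∣m+n∣m⇒∣n (2∣n+1 ξ≡1) 2∣n))
  where
  2α≤n+ : ∀ {k} → ∣ C ∣ ≡ k → 2 * ∣ S ∣ ≤ n + k
  2α≤n+ refl = 2α≤n+ξ G maxS core

  2∣n+1 : ∣ C ∣ ≡ 1 → 2 ∣ n + 1
  2∣n+1 ξ≡1 = subst (2 ∣_) 2α≡n+1 (m∣m*n ∣ S ∣)
    where
    2α≡n+1 : 2 * ∣ S ∣ ≡ n + 1
    2α≡n+1 = ≤-antisym (2α≤n+ ξ≡1) (subst (_≤ 2 * ∣ S ∣) (+-comm 1 n) n<2α)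

  2≢1 : ¬ (2 ≡ 1)
  2≢1 ()
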